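{- In the syntax of the single substitution calculus (SSC) with $\Pi$, $\mathsf{U}$, $\mathsf{Lift}$, every type $A:\mathsf{Ty}\,\Gamma\,i$ is $\alpha$-normal and every term $a:\mathsf{Tm}\,\Gamma\,A$ is $\alpha$-normal.
   Context: Work in extensional type theory (with UIP); coercions along equations are implicit. A model of the SSC with $\Pi,\mathsf{U},\mathsf{Lift}$ consists of: sorts $\mathsf{Con}:\mathsf{Set}$, $\mathsf{Ty}:\mathsf{Con}\to\mathbb{N}\to\mathsf{Set}$, $\mathsf{Sub}:\mathsf{Con}\to\mathsf{Con}\to\mathsf{Set}$, $\mathsf{Tm}:(\Gamma:\mathsf{Con})\to\mathsf{Ty}\,\Gamma\,i\to\mathsf{Set}$; operations $\diamond:\mathsf{Con}$; $\Gamma\triangleright A$ for $A:\mathsf{Ty}\,\Gamma\,i$; $\mathsf{p}:\mathsf{Sub}\,(\Gamma\triangleright A)\,\Gamma$; $\langle a\rangle:\mathsf{Sub}\,\Gamma\,(\Gamma\triangleright A)$ for $a:\mathsf{Tm}\,\Gamma\,A$; $\gamma^+:\mathsf{Sub}\,(\Delta\triangleright A[\gamma])\,(\Gamma\triangleright A)$ for $\gamma:\mathsf{Sub}\,\Delta\,\Gamma$; instantiation $A[\gamma]:\mathsf{Ty}\,\Delta\,i$ and $a[\gamma]:\mathsf{Tm}\,\Delta\,(A[\gamma])$; $\mathsf{q}:\mathsf{Tm}\,(\Gamma\triangleright A)\,(A[\mathsf{p}])$; equations $B[\mathsf{p}][\gamma^+]=B[\gamma][\mathsf{p}]$ and $b[\mathsf{p}][\gamma^+]=b[\gamma][\mathsf{p}]$,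 $\mathsf{q}[\gamma^+]=\mathsf{q}$, $B[\mathsf{p}][\langle a\rangle]=B$ and $b[\mathsf{p}][\langle a\rangle]=b$, $\mathsf{q}[\langle a\rangle]=a$, $B[\langle a\rangle][\gamma]=B[\gamma^+][\langle a[\gamma]\rangle]$ (types), $B[\mathsf{p}^+][\langle\mathsf{q}\rangle]=B$ (types). Type formers: $\Pi\,A\,B$ for $B:\mathsf{Ty}\,(\Gamma\triangleright A)\,i$, $(\Pi\,A\,B)[\gamma]=\Pi\,(A[\gamma])\,(B[\gamma^+])$; $\mathsf{lam}\,b:\mathsf{Tm}\,\Gamma\,(\Pi\,A\,B)$ for $b:\mathsf{Tm}\,(\Gamma\triangleright A)\,B$, $(\mathsf{lam}\,b)[\gamma]=\mathsf{lam}\,(b[\gamma^+])$; $t\cdot a:\mathsf{Tm}\,\Gamma\,(B[\langle a\rangle])$, $(t\cdot a)[\gamma]=t[\gamma]\cdot a[\gamma]$; $\mathsf{lam}\,b\cdot a=b[\langle a\rangle]$; $t=\mathsf{lam}\,(t[\mathsf{p}]\cdot\mathsf{q})$; $\mathsf{U}\,i:\mathsf{Ty}\,\Gamma\,(1+i)$, $(\mathsf{U}\,i)[\gamma]=\mathsf{U}\,i$; $\mathsf{El}:\mathsf{Tm}\,\Gamma\,(\mathsf{U}\,i)\to\mathsf{Ty}\,\Gamma\,i$, $\mathsf{c}:\mathsf{Ty}\,\Gamma\,i\to\mathsf{Tm}\,\Gamma\,(\mathsf{U}\,i)$, both commuting with instantiation, $\mathsf{El}\,(\mathsf{c}\,A)=A$,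 $\mathsf{c}\,(\mathsf{El}\,\hat A)=\hat A$; $\mathsf{Lift}\,A:\mathsf{Ty}\,\Gamma\,(1+i)$, $\mathsf{mk}:\mathsf{Tm}\,\Gamma\,A\to\mathsf{Tm}\,\Gamma\,(\mathsf{Lift}\,A)$, $\mathsf{un}$ in the opposite direction, all commuting with instantiation, $\mathsf{un}\,(\mathsf{mk}\,a)=a$, $\mathsf{mk}\,(\mathsf{un}\,a)=a$. The syntax is the initial model (a quotient inductive-inductive type). Variables and $\alpha$-normal forms are inductive predicates valued in propositions (proof-irrelevant/truncated), defined on the syntax: $\mathsf{q}:\mathsf{Tm}\,(\Gamma\triangleright A)\,(A[\mathsf{p}])$ is a variable; if $x:\mathsf{Tm}\,\Gamma\,B$ is a variable then $x[\mathsf{p}]:\mathsf{Tm}\,(\Gamma\triangleright A)\,(B[\mathsf{p}])$ is a variable. A term that is a variable is $\alpha$-normal. For every type or term former other than instantiation ($\Pi$, $\mathsf{lam}$, $\cdot$, $\mathsf{U}$, $\mathsf{El}$, $\mathsf{c}$, $\mathsf{Lift}$, $\mathsf{mk}$, $\mathsf{un}$), the result is $\alpha$-normal if all its type and term arguments (including the types indexing it, e.g. $f\cdot a$ is $\alpha$-normal if $A$, $B$ are $\alpha$-normal types and $f:\mathsf{Tm}\,\Gamma\,(\Pi\,A\,B)$, $a:\mathsf{Tm}\,\Gamma\,A$ are $\alpha$-normal terms; $\Pi\,A\,B$ is $\alpha$-normal if $A$, $B$ are). No clause declares instantiated types or terms $\alpha$-normal, except variables. -}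

module Defs where

-- Extensional type theory with UIP is modelled by Agda with K (the
-- default); "implicit coercions along equations" are rendered either by
-- explicit 'subst' or by heterogeneous equality '_≅_'.

open import Data.Nat using (ℕ; suc)
open import Relation.Binary.PropositionalEquality using (_≡_; refl; subst)
open import Relation.Binary.HeterogeneousEquality using (_≅_; refl)

coe∙ : {A : Set} {B : A → Set} {T : A → Set}
       (C : (a : A) → B a → T a → Set)
       {a a' : A} {b : B a} {b' : B a'} {t : T a}
       (e : a ≡ a') → b ≅ b' → C a b t → C a' b' (subst T e t)
coe∙ C refl refl c = c

coeF : {X : Set} {F : X → Set} (G : (x : X) → F x → Set)
       {x x' : X} (e : x ≡ x') {f : F x} → G x f → G x' (subst F e f)
coeF G refl c = c

record Model : Set₁ where
  infixl 5 _▹_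
  infixl 8 _[_]T _[_]t
  infixl 7 _·_
  field
    Con : Set
    Ty  : Con → ℕ → Set
    Sub : Con → Con → Set
    Tm  : (Γ : Con) {i : ℕ} → Ty Γ i → Set

    ◇    : Con
    _▹_  : (Γ : Con) {i : ℕ} → Ty Γ i → Con
    _[_]T : ∀ {Γ Δ i} → Ty Γ i → Sub Δ Γ → Ty Δ i
    _[_]t : ∀ {Γ Δ i} {A : Ty Γ i} → Tm Γ A → (γ : Sub Δ Γ) → Tm Δ (A [ γ ]T)
    p    : ∀ {Γ i} (A : Ty Γ i) → Sub (Γ ▹ A) Γ
    q    : ∀ {Γ i} (A : Ty Γ i) → Tm (Γ ▹ A) (A [ p A ]T)
    ⟨_⟩  : ∀ {Γ i} {A : Ty Γ i} → Tm Γ A → Sub Γ (Γ ▹ A)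
    up   : ∀ {Γ Δ i} (A : Ty Γ i) (γ : Sub Δ Γ) → Sub (Δ ▹ A [ γ ]T) (Γ ▹ A)

    [p][up]T : ∀ {Γ Δ i j} {A : Ty Γ i} {B : Ty Γ j} {γ : Sub Δ Γ} →
               B [ p A ]T [ up A γ ]T ≡ B [ γ ]T [ p (A [ γ ]T) ]T
    [p][up]t : ∀ {Γ Δ i j} {A : Ty Γ i} {B : Ty Γ j} {b : Tm Γ B} {γ : Sub Δ Γ} →
               b [ p A ]t [ up A γ ]t ≅ b [ γ ]t [ p (A [ γ ]T) ]t
    q[up]    : ∀ {Γ Δ i} {A : Ty Γ i} {γ : Sub Δ Γ} →
               q A [ up A γ ]t ≅ q (A [ γ ]T)
    [p][⟨⟩]T : ∀ {Γ i j} {A : Ty Γ i} {B : Ty Γ j} {a : Tm Γ A} →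
               B [ p A ]T [ ⟨ a ⟩ ]T ≡ B
    [p][⟨⟩]t : ∀ {Γ i j} {A : Ty Γ i} {B : Ty Γ j} {b : Tm Γ B} {a : Tm Γ A} →
               b [ p A ]t [ ⟨ a ⟩ ]t ≅ b
    q[⟨⟩]    : ∀ {Γ i} {A : Ty Γ i} {a : Tm Γ A} →
               q A [ ⟨ a ⟩ ]t ≅ a
    [⟨⟩][]T  : ∀ {Γ Δ i j} {A : Ty Γ i} {B : Ty (Γ ▹ A) j} {a : Tm Γ A} {γ : Sub Δ Γ} →
               B [ ⟨ a ⟩ ]T [ γ ]T ≡ B [ up A γ ]T [ ⟨ a [ γ ]t ⟩ ]T
    [up][⟨q⟩]T : ∀ {Γ i j} {A : Ty Γ i} {B : Ty (Γ ▹ A) j} →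
               B [ up A (p A) ]T [ ⟨ q A ⟩ ]T ≡ B

    Π    : ∀ {Γ i} (A : Ty Γ i) → Ty (Γ ▹ A) i → Ty Γ i
    Π[]  : ∀ {Γ Δ i} {A : Ty Γ i} {B : Ty (Γ ▹ A) i} {γ : Sub Δ Γ} →
           Π A B [ γ ]T ≡ Π (A [ γ ]T) (B [ up A γ ]T)
    lam  : ∀ {Γ i} {A : Ty Γ i} {B : Ty (Γ ▹ A) i} → Tm (Γ ▹ A) B → Tm Γ (Π A B)
    lam[] : ∀ {Γ Δ i} {A : Ty Γ i} {B : Ty (Γ ▹ A) i} {b : Tm (Γ ▹ A) B} {γ : Sub Δ Γ} →
            lam b [ γ ]t ≅ lam (b [ up A γ ]t)
    _·_  : ∀ {Γ i} {A : Ty Γ i} {B : Ty (Γ ▹ A) i} →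
           Tm Γ (Π A B) → (a : Tm Γ A) → Tm Γ (B [ ⟨ a ⟩ ]T)
    ·[]  : ∀ {Γ Δ i} {A : Ty Γ i} {B : Ty (Γ ▹ A) i}
             {t : Tm Γ (Π A B)} {a : Tm Γ A} {γ : Sub Δ Γ} →
           (t · a) [ γ ]t ≅ subst (Tm Δ) (Π[] {A = A} {B = B} {γ = γ}) (t [ γ ]t) · a [ γ ]t
    Πβ   : ∀ {Γ i} {A : Ty Γ i} {B : Ty (Γ ▹ A) i} {b : Tm (Γ ▹ A) B} {a : Tm Γ A} →
           lam b · a ≡ b [ ⟨ a ⟩ ]t
    Πη   : ∀ {Γ i} {A : Ty Γ i} {B : Ty (Γ ▹ A) i} {t : Tm Γ (Π A B)} →
           t ≅ lam (subst (Tm (Γ ▹ A)) (Π[] {A = A} {B = B} {γ = p A}) (t [ p A ]t) · q A)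

    U    : ∀ {Γ} (i : ℕ) → Ty Γ (suc i)
    U[]  : ∀ {Γ Δ i} {γ : Sub Δ Γ} → U i [ γ ]T ≡ U i
    El   : ∀ {Γ i} → Tm Γ (U i) → Ty Γ i
    El[] : ∀ {Γ Δ i} {a : Tm Γ (U i)} {γ : Sub Δ Γ} →
           El a [ γ ]T ≡ El (subst (Tm Δ) (U[] {i = i} {γ = γ}) (a [ γ ]t))
    c    : ∀ {Γ i} → Ty Γ i → Tm Γ (U i)
    c[]  : ∀ {Γ Δ i} {A : Ty Γ i} {γ : Sub Δ Γ} →
           c A [ γ ]t ≅ c (A [ γ ]T)
    Elc  : ∀ {Γ i} {A : Ty Γ i} → El (c A) ≡ A
    cEl  : ∀ {Γ i} {a : Tm Γ (U i)} → c (El a) ≡ a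

    Lift   : ∀ {Γ i} → Ty Γ i → Ty Γ (suc i)
    Lift[] : ∀ {Γ Δ i} {A : Ty Γ i} {γ : Sub Δ Γ} → Lift A [ γ ]T ≡ Lift (A [ γ ]T)
    mk     : ∀ {Γ i} {A : Ty Γ i} → Tm Γ A → Tm Γ (Lift A)
    mk[]   : ∀ {Γ Δ i} {A : Ty Γ i} {a : Tm Γ A} {γ : Sub Δ Γ} →
             mk a [ γ ]t ≅ mk (a [ γ ]t)
    un     : ∀ {Γ i} {A : Ty Γ i} → Tm Γ (Lift A) → Tm Γ A
    un[]   : ∀ {Γ Δ i} {A : Ty Γ i} {a : Tm Γ (Lift A)} {γ : Sub Δ Γ} →
             un a [ γ ]t ≡ un (subst (Tm Δ) (Lift[] {A = A} {γ = γ}) (a [ γ ]t))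
    Liftβ  : ∀ {Γ i} {A : Ty Γ i} {a : Tm Γ A} → un (mk a) ≡ a
    Liftη  : ∀ {Γ i} {A : Ty Γ i} {a : Tm Γ (Lift A)} → mk (un a) ≡ a

record DModel (M : Model) : Set₁ where
  open Model M
  infixl 5 _▹∙_
  infixl 8 _[_]T∙ _[_]t∙
  infixl 7 _·∙_
  field
    Con∙ : Con → Set
    Ty∙  : ∀ {Γ i} → Con∙ Γ → Ty Γ i → Set
    Sub∙ : ∀ {Δ Γ} → Con∙ Δ → Con∙ Γ → Sub Δ Γ → Set
    Tm∙  : ∀ {Γ i} {A : Ty Γ i} (Γ∙ : Con∙ Γ) → Ty∙ Γ∙ A → Tm Γ A → Set

    ◇∙    : Con∙ ◇
    _▹∙_  : ∀ {Γ i} {A : Ty Γ i} (Γ∙ : Con∙ Γ) → Ty∙ Γ∙ A → Con∙ (Γ ▹ A)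
    _[_]T∙ : ∀ {Γ Δ i} {A : Ty Γ i} {γ : Sub Δ Γ} {Γ∙ : Con∙ Γ} {Δ∙ : Con∙ Δ} →
             Ty∙ Γ∙ A → Sub∙ Δ∙ Γ∙ γ → Ty∙ Δ∙ (A [ γ ]T)
    _[_]t∙ : ∀ {Γ Δ i} {A : Ty Γ i} {a : Tm Γ A} {γ : Sub Δ Γ}
               {Γ∙ : Con∙ Γ} {Δ∙ : Con∙ Δ} {A∙ : Ty∙ Γ∙ A} →
             Tm∙ Γ∙ A∙ a → (γ∙ : Sub∙ Δ∙ Γ∙ γ) → Tm∙ Δ∙ (A∙ [ γ∙ ]T∙) (a [ γ ]t)
    p∙    : ∀ {Γ i} {A : Ty Γ i} {Γ∙ : Con∙ Γ} (A∙ : Ty∙ Γ∙ A) →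
            Sub∙ (Γ∙ ▹∙ A∙) Γ∙ (p A)
    q∙    : ∀ {Γ i} {A : Ty Γ i} {Γ∙ : Con∙ Γ} (A∙ : Ty∙ Γ∙ A) →
            Tm∙ (Γ∙ ▹∙ A∙) (A∙ [ p∙ A∙ ]T∙) (q A)
    ⟨_⟩∙  : ∀ {Γ i} {A : Ty Γ i} {a : Tm Γ A} {Γ∙ : Con∙ Γ} {A∙ : Ty∙ Γ∙ A} →
            Tm∙ Γ∙ A∙ a → Sub∙ Γ∙ (Γ∙ ▹∙ A∙) ⟨ a ⟩
    up∙   : ∀ {Γ Δ i} {A : Ty Γ i} {γ : Sub Δ Γ} {Γ∙ : Con∙ Γ} {Δ∙ : Con∙ Δ}
              (A∙ : Ty∙ Γ∙ A) (γ∙ : Sub∙ Δ∙ Γ∙ γ) →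
            Sub∙ (Δ∙ ▹∙ A∙ [ γ∙ ]T∙) (Γ∙ ▹∙ A∙) (up A γ)

    [p][up]T∙ : ∀ {Γ Δ i j} {A : Ty Γ i} {B : Ty Γ j} {γ : Sub Δ Γ}
                  {Γ∙ : Con∙ Γ} {Δ∙ : Con∙ Δ} {A∙ : Ty∙ Γ∙ A} {B∙ : Ty∙ Γ∙ B}
                  {γ∙ : Sub∙ Δ∙ Γ∙ γ} →
                B∙ [ p∙ A∙ ]T∙ [ up∙ A∙ γ∙ ]T∙ ≅ B∙ [ γ∙ ]T∙ [ p∙ (A∙ [ γ∙ ]T∙) ]T∙
    [p][up]t∙ : ∀ {Γ Δ i j} {A : Ty Γ i} {B : Ty Γ j} {b : Tm Γ B} {γ : Sub Δ Γ}
                  {Γ∙ : Con∙ Γ} {Δ∙ : Con∙ Δ} {A∙ : Ty∙ Γ∙ A} {B∙ : Ty∙ Γ∙ B}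
                  {b∙ : Tm∙ Γ∙ B∙ b} {γ∙ : Sub∙ Δ∙ Γ∙ γ} →
                b∙ [ p∙ A∙ ]t∙ [ up∙ A∙ γ∙ ]t∙ ≅ b∙ [ γ∙ ]t∙ [ p∙ (A∙ [ γ∙ ]T∙) ]t∙
    q[up]∙    : ∀ {Γ Δ i} {A : Ty Γ i} {γ : Sub Δ Γ}
                  {Γ∙ : Con∙ Γ} {Δ∙ : Con∙ Δ} {A∙ : Ty∙ Γ∙ A} {γ∙ : Sub∙ Δ∙ Γ∙ γ} →
                q∙ A∙ [ up∙ A∙ γ∙ ]t∙ ≅ q∙ (A∙ [ γ∙ ]T∙)
    [p][⟨⟩]T∙ : ∀ {Γ i j} {A : Ty Γ i} {B : Ty Γ j} {a : Tm Γ A}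
                  {Γ∙ : Con∙ Γ} {A∙ : Ty∙ Γ∙ A} {B∙ : Ty∙ Γ∙ B} {a∙ : Tm∙ Γ∙ A∙ a} →
                B∙ [ p∙ A∙ ]T∙ [ ⟨ a∙ ⟩∙ ]T∙ ≅ B∙
    [p][⟨⟩]t∙ : ∀ {Γ i j} {A : Ty Γ i} {B : Ty Γ j} {b : Tm Γ B} {a : Tm Γ A}
                  {Γ∙ : Con∙ Γ} {A∙ : Ty∙ Γ∙ A} {B∙ : Ty∙ Γ∙ B}
                  {b∙ : Tm∙ Γ∙ B∙ b} {a∙ : Tm∙ Γ∙ A∙ a} →
                b∙ [ p∙ A∙ ]t∙ [ ⟨ a∙ ⟩∙ ]t∙ ≅ b∙
    q[⟨⟩]∙    : ∀ {Γ i} {A : Ty Γ i} {a : Tm Γ A}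
                  {Γ∙ : Con∙ Γ} {A∙ : Ty∙ Γ∙ A} {a∙ : Tm∙ Γ∙ A∙ a} →
                q∙ A∙ [ ⟨ a∙ ⟩∙ ]t∙ ≅ a∙
    [⟨⟩][]T∙  : ∀ {Γ Δ i j} {A : Ty Γ i} {B : Ty (Γ ▹ A) j} {a : Tm Γ A} {γ : Sub Δ Γ}
                  {Γ∙ : Con∙ Γ} {Δ∙ : Con∙ Δ} {A∙ : Ty∙ Γ∙ A} {B∙ : Ty∙ (Γ∙ ▹∙ A∙) B}
                  {a∙ : Tm∙ Γ∙ A∙ a} {γ∙ : Sub∙ Δ∙ Γ∙ γ} →
                B∙ [ ⟨ a∙ ⟩∙ ]T∙ [ γ∙ ]T∙ ≅ B∙ [ up∙ A∙ γ∙ ]T∙ [ ⟨ a∙ [ γ∙ ]t∙ ⟩∙ ]T∙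
    [up][⟨q⟩]T∙ : ∀ {Γ i j} {A : Ty Γ i} {B : Ty (Γ ▹ A) j}
                  {Γ∙ : Con∙ Γ} {A∙ : Ty∙ Γ∙ A} {B∙ : Ty∙ (Γ∙ ▹∙ A∙) B} →
                B∙ [ up∙ A∙ (p∙ A∙) ]T∙ [ ⟨ q∙ A∙ ⟩∙ ]T∙ ≅ B∙

    Π∙    : ∀ {Γ i} {A : Ty Γ i} {B : Ty (Γ ▹ A) i} {Γ∙ : Con∙ Γ}
              (A∙ : Ty∙ Γ∙ A) → Ty∙ (Γ∙ ▹∙ A∙) B → Ty∙ Γ∙ (Π A B)
    Π[]∙  : ∀ {Γ Δ i} {A : Ty Γ i} {B : Ty (Γ ▹ A) i} {γ : Sub Δ Γ}
              {Γ∙ : Con∙ Γ} {Δ∙ : Con∙ Δ} {A∙ : Ty∙ Γ∙ A} {B∙ : Ty∙ (Γ∙ ▹∙ A∙) B}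
              {γ∙ : Sub∙ Δ∙ Γ∙ γ} →
            Π∙ A∙ B∙ [ γ∙ ]T∙ ≅ Π∙ (A∙ [ γ∙ ]T∙) (B∙ [ up∙ A∙ γ∙ ]T∙)
    lam∙  : ∀ {Γ i} {A : Ty Γ i} {B : Ty (Γ ▹ A) i} {b : Tm (Γ ▹ A) B}
              {Γ∙ : Con∙ Γ} {A∙ : Ty∙ Γ∙ A} {B∙ : Ty∙ (Γ∙ ▹∙ A∙) B} →
            Tm∙ (Γ∙ ▹∙ A∙) B∙ b → Tm∙ Γ∙ (Π∙ A∙ B∙) (lam b)
    lam[]∙ : ∀ {Γ Δ i} {A : Ty Γ i} {B : Ty (Γ ▹ A) i} {b : Tm (Γ ▹ A) B} {γ : Sub Δ Γ}
              {Γ∙ : Con∙ Γ} {Δ∙ : Con∙ Δ} {A∙ : Ty∙ Γ∙ A} {B∙ : Ty∙ (Γ∙ ▹∙ A∙) B}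
              {b∙ : Tm∙ (Γ∙ ▹∙ A∙) B∙ b} {γ∙ : Sub∙ Δ∙ Γ∙ γ} →
            lam∙ b∙ [ γ∙ ]t∙ ≅ lam∙ (b∙ [ up∙ A∙ γ∙ ]t∙)
    _·∙_  : ∀ {Γ i} {A : Ty Γ i} {B : Ty (Γ ▹ A) i} {t : Tm Γ (Π A B)} {a : Tm Γ A}
              {Γ∙ : Con∙ Γ} {A∙ : Ty∙ Γ∙ A} {B∙ : Ty∙ (Γ∙ ▹∙ A∙) B} →
            Tm∙ Γ∙ (Π∙ A∙ B∙) t → (a∙ : Tm∙ Γ∙ A∙ a) → Tm∙ Γ∙ (B∙ [ ⟨ a∙ ⟩∙ ]T∙) (t · a)
    ·[]∙  : ∀ {Γ Δ i} {A : Ty Γ i} {B : Ty (Γ ▹ A) i}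
              {t : Tm Γ (Π A B)} {a : Tm Γ A} {γ : Sub Δ Γ}
              {Γ∙ : Con∙ Γ} {Δ∙ : Con∙ Δ} {A∙ : Ty∙ Γ∙ A} {B∙ : Ty∙ (Γ∙ ▹∙ A∙) B}
              {t∙ : Tm∙ Γ∙ (Π∙ A∙ B∙) t} {a∙ : Tm∙ Γ∙ A∙ a} {γ∙ : Sub∙ Δ∙ Γ∙ γ} →
            (t∙ ·∙ a∙) [ γ∙ ]t∙ ≅
              coe∙ (λ X X∙ x → Tm∙ {A = X} Δ∙ X∙ x) (Π[] {A = A} {B = B} {γ = γ})
                   (Π[]∙ {A∙ = A∙} {B∙ = B∙} {γ∙ = γ∙}) (t∙ [ γ∙ ]t∙)
              ·∙ a∙ [ γ∙ ]t∙
    Πβ∙   : ∀ {Γ i} {A : Ty Γ i} {B : Ty (Γ ▹ A) i} {b : Tm (Γ ▹ A) B} {a : Tm Γ A}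
              {Γ∙ : Con∙ Γ} {A∙ : Ty∙ Γ∙ A} {B∙ : Ty∙ (Γ∙ ▹∙ A∙) B}
              {b∙ : Tm∙ (Γ∙ ▹∙ A∙) B∙ b} {a∙ : Tm∙ Γ∙ A∙ a} →
            lam∙ b∙ ·∙ a∙ ≅ b∙ [ ⟨ a∙ ⟩∙ ]t∙
    Πη∙   : ∀ {Γ i} {A : Ty Γ i} {B : Ty (Γ ▹ A) i} {t : Tm Γ (Π A B)}
              {Γ∙ : Con∙ Γ} {A∙ : Ty∙ Γ∙ A} {B∙ : Ty∙ (Γ∙ ▹∙ A∙) B}
              {t∙ : Tm∙ Γ∙ (Π∙ A∙ B∙) t} →
            t∙ ≅ lam∙ (coe∙ (λ X X∙ x → Tm∙ {A = X} (Γ∙ ▹∙ A∙) X∙ x) (Π[] {A = A} {B = B} {γ = p A})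
                            (Π[]∙ {A∙ = A∙} {B∙ = B∙} {γ∙ = p∙ A∙}) (t∙ [ p∙ A∙ ]t∙)
                       ·∙ q∙ A∙)

    U∙    : ∀ {Γ} {Γ∙ : Con∙ Γ} (i : ℕ) → Ty∙ Γ∙ (U i)
    U[]∙  : ∀ {Γ Δ i} {γ : Sub Δ Γ} {Γ∙ : Con∙ Γ} {Δ∙ : Con∙ Δ} {γ∙ : Sub∙ Δ∙ Γ∙ γ} →
            U∙ i [ γ∙ ]T∙ ≅ U∙ {Γ∙ = Δ∙} i
    El∙   : ∀ {Γ i} {a : Tm Γ (U i)} {Γ∙ : Con∙ Γ} →
            Tm∙ Γ∙ (U∙ i) a → Ty∙ Γ∙ (El a)
    El[]∙ : ∀ {Γ Δ i} {a : Tm Γ (U i)} {γ : Sub Δ Γ}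
              {Γ∙ : Con∙ Γ} {Δ∙ : Con∙ Δ} {a∙ : Tm∙ Γ∙ (U∙ i) a} {γ∙ : Sub∙ Δ∙ Γ∙ γ} →
            El∙ a∙ [ γ∙ ]T∙ ≅
              El∙ (coe∙ (λ X X∙ x → Tm∙ {A = X} Δ∙ X∙ x) (U[] {i = i} {γ = γ})
                        (U[]∙ {γ∙ = γ∙}) (a∙ [ γ∙ ]t∙))
    c∙    : ∀ {Γ i} {A : Ty Γ i} {Γ∙ : Con∙ Γ} → Ty∙ Γ∙ A → Tm∙ Γ∙ (U∙ i) (c A)
    c[]∙  : ∀ {Γ Δ i} {A : Ty Γ i} {γ : Sub Δ Γ}
              {Γ∙ : Con∙ Γ} {Δ∙ : Con∙ Δ} {A∙ : Ty∙ Γ∙ A} {γ∙ : Sub∙ Δ∙ Γ∙ γ} →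
            c∙ A∙ [ γ∙ ]t∙ ≅ c∙ (A∙ [ γ∙ ]T∙)
    Elc∙  : ∀ {Γ i} {A : Ty Γ i} {Γ∙ : Con∙ Γ} {A∙ : Ty∙ Γ∙ A} → El∙ (c∙ A∙) ≅ A∙
    cEl∙  : ∀ {Γ i} {a : Tm Γ (U i)} {Γ∙ : Con∙ Γ} {a∙ : Tm∙ Γ∙ (U∙ i) a} →
            c∙ (El∙ a∙) ≅ a∙

    Lift∙   : ∀ {Γ i} {A : Ty Γ i} {Γ∙ : Con∙ Γ} → Ty∙ Γ∙ A → Ty∙ Γ∙ (Lift A)
    Lift[]∙ : ∀ {Γ Δ i} {A : Ty Γ i} {γ : Sub Δ Γ}
                {Γ∙ : Con∙ Γ} {Δ∙ : Con∙ Δ} {A∙ : Ty∙ Γ∙ A} {γ∙ : Sub∙ Δ∙ Γ∙ γ} →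
              Lift∙ A∙ [ γ∙ ]T∙ ≅ Lift∙ (A∙ [ γ∙ ]T∙)
    mk∙     : ∀ {Γ i} {A : Ty Γ i} {a : Tm Γ A} {Γ∙ : Con∙ Γ} {A∙ : Ty∙ Γ∙ A} →
              Tm∙ Γ∙ A∙ a → Tm∙ Γ∙ (Lift∙ A∙) (mk a)
    mk[]∙   : ∀ {Γ Δ i} {A : Ty Γ i} {a : Tm Γ A} {γ : Sub Δ Γ}
                {Γ∙ : Con∙ Γ} {Δ∙ : Con∙ Δ} {A∙ : Ty∙ Γ∙ A} {a∙ : Tm∙ Γ∙ A∙ a}
                {γ∙ : Sub∙ Δ∙ Γ∙ γ} →
              mk∙ a∙ [ γ∙ ]t∙ ≅ mk∙ (a∙ [ γ∙ ]t∙)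
    un∙     : ∀ {Γ i} {A : Ty Γ i} {a : Tm Γ (Lift A)} {Γ∙ : Con∙ Γ} {A∙ : Ty∙ Γ∙ A} →
              Tm∙ Γ∙ (Lift∙ A∙) a → Tm∙ Γ∙ A∙ (un a)
    un[]∙   : ∀ {Γ Δ i} {A : Ty Γ i} {a : Tm Γ (Lift A)} {γ : Sub Δ Γ}
                {Γ∙ : Con∙ Γ} {Δ∙ : Con∙ Δ} {A∙ : Ty∙ Γ∙ A} {a∙ : Tm∙ Γ∙ (Lift∙ A∙) a}
                {γ∙ : Sub∙ Δ∙ Γ∙ γ} →
              un∙ a∙ [ γ∙ ]t∙ ≅
                un∙ (coe∙ (λ X X∙ x → Tm∙ {A = X} Δ∙ X∙ x) (Lift[] {A = A} {γ = γ})
                          (Lift[]∙ {A∙ = A∙} {γ∙ = γ∙}) (a∙ [ γ∙ ]t∙))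
    Liftβ∙  : ∀ {Γ i} {A : Ty Γ i} {a : Tm Γ A} {Γ∙ : Con∙ Γ} {A∙ : Ty∙ Γ∙ A}
                {a∙ : Tm∙ Γ∙ A∙ a} → un∙ (mk∙ a∙) ≅ a∙
    Liftη∙  : ∀ {Γ i} {A : Ty Γ i} {a : Tm Γ (Lift A)} {Γ∙ : Con∙ Γ} {A∙ : Ty∙ Γ∙ A}
                {a∙ : Tm∙ Γ∙ (Lift∙ A∙) a} → mk∙ (un∙ a∙) ≅ a∙

record Section {M : Model} (D : DModel M) : Set where
  open Model M
  open DModel D
  field
    Con∘ : (Γ : Con) → Con∙ Γ
    Ty∘  : ∀ {Γ i} (A : Ty Γ i) → Ty∙ (Con∘ Γ) A
    Sub∘ : ∀ {Δ Γ} (γ : Sub Δ Γ) → Sub∙ (Con∘ Δ) (Con∘ Γ) γ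
    Tm∘  : ∀ {Γ i} {A : Ty Γ i} (a : Tm Γ A) → Tm∙ (Con∘ Γ) (Ty∘ A) a

    ◇∘   : Con∘ ◇ ≡ ◇∙
    ▹∘   : ∀ {Γ i} {A : Ty Γ i} → Con∘ (Γ ▹ A) ≡ Con∘ Γ ▹∙ Ty∘ A
    []T∘ : ∀ {Γ Δ i} {A : Ty Γ i} {γ : Sub Δ Γ} → Ty∘ (A [ γ ]T) ≡ Ty∘ A [ Sub∘ γ ]T∙
    []t∘ : ∀ {Γ Δ i} {A : Ty Γ i} {a : Tm Γ A} {γ : Sub Δ Γ} →
           Tm∘ (a [ γ ]t) ≅ Tm∘ a [ Sub∘ γ ]t∙
    p∘   : ∀ {Γ i} {A : Ty Γ i} → Sub∘ (p A) ≅ p∙ (Ty∘ A)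
    q∘   : ∀ {Γ i} {A : Ty Γ i} → Tm∘ (q A) ≅ q∙ (Ty∘ A)
    ⟨⟩∘  : ∀ {Γ i} {A : Ty Γ i} {a : Tm Γ A} → Sub∘ ⟨ a ⟩ ≅ ⟨ Tm∘ a ⟩∙
    up∘  : ∀ {Γ Δ i} {A : Ty Γ i} {γ : Sub Δ Γ} → Sub∘ (up A γ) ≅ up∙ (Ty∘ A) (Sub∘ γ)

    Π∘   : ∀ {Γ i} {A : Ty Γ i} {B : Ty (Γ ▹ A) i} →
           Ty∘ (Π A B) ≡ Π∙ (Ty∘ A) (subst (λ X → Ty∙ X B) ▹∘ (Ty∘ B))
    lam∘ : ∀ {Γ i} {A : Ty Γ i} {B : Ty (Γ ▹ A) i} {b : Tm (Γ ▹ A) B} →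
           Tm∘ (lam b) ≅ lam∙ (coeF (λ X X∙ → Tm∙ X X∙ b) ▹∘ (Tm∘ b))
    ·∘   : ∀ {Γ i} {A : Ty Γ i} {B : Ty (Γ ▹ A) i} {t : Tm Γ (Π A B)} {a : Tm Γ A} →
           Tm∘ (t · a) ≅ subst (λ X → Tm∙ (Con∘ Γ) X t) Π∘ (Tm∘ t) ·∙ Tm∘ a
    U∘   : ∀ {Γ i} → Ty∘ {Γ} (U i) ≡ U∙ i
    El∘  : ∀ {Γ i} {a : Tm Γ (U i)} →
           Ty∘ (El a) ≡ El∙ (subst (λ X → Tm∙ (Con∘ Γ) X a) U∘ (Tm∘ a))
    c∘   : ∀ {Γ i} {A : Ty Γ i} → Tm∘ (c A) ≅ c∙ (Ty∘ A)
    Lift∘ : ∀ {Γ i} {A : Ty Γ i} → Ty∘ (Lift A) ≡ Lift∙ (Ty∘ A)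
    mk∘  : ∀ {Γ i} {A : Ty Γ i} {a : Tm Γ A} → Tm∘ (mk a) ≅ mk∙ (Tm∘ a)
    un∘  : ∀ {Γ i} {A : Ty Γ i} {a : Tm Γ (Lift A)} →
           Tm∘ (un a) ≡ un∙ (subst (λ X → Tm∙ (Con∘ Γ) X a) Lift∘ (Tm∘ a))

-- A model is (the) syntax when it satisfies the induction principle of the
-- quotient inductive-inductive type: every displayed model over it has a
-- section.
IsSyntax : Model → Set₁
IsSyntax M = (D : DModel M) → Section D

module _ (M : Model) where
  open Model M

  data IsVar : ∀ {Γ i} {A : Ty Γ i} → Tm Γ A → Set where
    var-q : ∀ {Γ i} {A : Ty Γ i} → IsVar (q A)
    var-p : ∀ {Γ i j} {A : Ty Γ i} {B : Ty Γ j} {x : Tm Γ B} →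
            IsVar x → IsVar (x [ p A ]t)

  data NfTy : ∀ {Γ i} → Ty Γ i → Set
  data NfTm : ∀ {Γ i} {A : Ty Γ i} → Tm Γ A → Set

  data NfTy where
    nf-Π    : ∀ {Γ i} {A : Ty Γ i} {B : Ty (Γ ▹ A) i} →
              NfTy A → NfTy B → NfTy (Π A B)
    nf-U    : ∀ {Γ i} → NfTy {Γ} (U i)
    nf-El   : ∀ {Γ i} {a : Tm Γ (U i)} → NfTy {Γ} (U i) → NfTm a → NfTy (El a)
    nf-Lift : ∀ {Γ i} {A : Ty Γ i} → NfTy A → NfTy (Lift A)

  data NfTm where
    nf-var : ∀ {Γ i} {A : Ty Γ i} {a : Tm Γ A} → IsVar a → NfTm a
    nf-lam : ∀ {Γ i} {A : Ty Γ i} {B : Ty (Γ ▹ A) i} {b : Tm (Γ ▹ A) B} →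
             NfTy A → NfTy B → NfTm b → NfTm (lam b)
    nf-app : ∀ {Γ i} {A : Ty Γ i} {B : Ty (Γ ▹ A) i} {t : Tm Γ (Π A B)} {a : Tm Γ A} →
             NfTy A → NfTy B → NfTm t → NfTm a → NfTm (t · a)
    nf-c   : ∀ {Γ i} {A : Ty Γ i} → NfTy A → NfTm (c A)
    nf-mk  : ∀ {Γ i} {A : Ty Γ i} {a : Tm Γ A} → NfTy A → NfTm a → NfTm (mk a)
    nf-un  : ∀ {Γ i} {A : Ty Γ i} {a : Tm Γ (Lift A)} →
             NfTy A → NfTm a → NfTm (un a)

{-# OPTIONS --safe #-}

-- The theorem is proved by eliminating the syntax into the displayed model
-- whose types and terms are the truncated α-normality witnesses and whose
-- substitutions are those sending every variable to an α-normal term.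
-- Truncation makes all its equations hold trivially, so the content lies in
-- the operations: α-normal forms are stable under instantiation by such
-- substitutions (by induction on the normal form), and p, ⟨ a ⟩ and γ⁺ are
-- such substitutions.  For γ⁺ one inverts a variable over Γ ▹ A into q or a
-- weakened variable, which rests on the injectivity of _▹_; the latter comes
-- from eliminating into a displayed model with constant contexts.

module Submission where

open import Data.Irrelevant using (Irrelevant; [_]; pure; _<*>_; map)
open import Data.Nat using (ℕ)
open import Data.Product using (Σ; _×_; _,_)
open import Data.Unit using (⊤; tt)
open import Function using (id)
open import Relation.Binary.PropositionalEquality using (_≡_; refl; sym; trans; cong; subst)
open import Relation.Binary.HeterogeneousEquality as ≅ using (_≅_; refl; ≡-to-≅)

open import Defs

Irrelevant-≅ : ∀ {X Y : Set} → X ≡ Y → (x : Irrelevant X) (y : Irrelevant Y) → x ≅ y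
Irrelevant-≅ refl _ _ = refl

module Properties (M : Model) where
  open Model M

  Tm-cong : (P : ∀ {Γ i} {A : Ty Γ i} → Tm Γ A → Set)
            {Γ : Con} {i : ℕ} {A A' : Ty Γ i} {a : Tm Γ A} {a' : Tm Γ A'} →
            A ≡ A' → a ≅ a' → P a ≡ P a'
  Tm-cong P refl refl = refl

  Tm-subst : (P : ∀ {Γ i} {A : Ty Γ i} → Tm Γ A → Set)
             {Γ : Con} {i : ℕ} {A A' : Ty Γ i} {a : Tm Γ A} {a' : Tm Γ A'} →
             A ≡ A' → a ≅ a' → P a → P a'
  Tm-subst P refl refl pa = pa

  NfTm-subst : ∀ {Γ i} {A A' : Ty Γ i} {a : Tm Γ A} (e : A ≡ A') →
               NfTm M a → NfTm M (subst (Tm Γ) e a)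
  NfTm-subst refl na = na

  constDModel : (X : Set) → X → (∀ {Γ i} → Ty Γ i → X) → DModel M
  constDModel X x◇ x▹ = record
    { Con∙ = λ _ → X
    ; Ty∙ = λ _ _ → ⊤
    ; Sub∙ = λ _ _ _ → ⊤
    ; Tm∙ = λ _ _ _ → ⊤
    ; ◇∙ = x◇
    ; _▹∙_ = λ {A = A} _ _ → x▹ A
    ; _[_]T∙ = λ _ _ → tt
    ; _[_]t∙ = λ _ _ → tt
    ; p∙ = λ _ → tt
    ; q∙ = λ _ → tt
    ; ⟨_⟩∙ = λ _ → tt
    ; up∙ = λ _ _ → tt
    ; [p][up]T∙ = refl
    ; [p][up]t∙ = refl
    ; q[up]∙ = refl
    ; [p][⟨⟩]T∙ = refl
    ; [p][⟨⟩]t∙ = refl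
    ; q[⟨⟩]∙ = refl
    ; [⟨⟩][]T∙ = refl
    ; [up][⟨q⟩]T∙ = refl
    ; Π∙ = λ _ _ → tt
    ; Π[]∙ = refl
    ; lam∙ = λ _ → tt
    ; lam[]∙ = refl
    ; _·∙_ = λ _ _ → tt
    ; ·[]∙ = refl
    ; Πβ∙ = refl
    ; Πη∙ = refl
    ; U∙ = λ _ → tt
    ; U[]∙ = refl
    ; El∙ = λ _ → tt
    ; El[]∙ = refl
    ; c∙ = λ _ → tt
    ; c[]∙ = refl
    ; Elc∙ = refl
    ; cEl∙ = refl
    ; Lift∙ = λ _ → tt
    ; Lift[]∙ = refl
    ; mk∙ = λ _ → tt
    ; mk[]∙ = refl
    ; un∙ = λ _ → tt
    ; un[]∙ = refl
    ; Liftβ∙ = refl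
    ; Liftη∙ = refl
    }

  module Instantiation
    (Admissible : ∀ {Δ Γ} → Sub Δ Γ → Set)
    (admissible-var : ∀ {Δ Γ} {γ : Sub Δ Γ} → Admissible γ →
                      ∀ {j} {C : Ty Γ j} {x : Tm Γ C} → IsVar M x → NfTm M (x [ γ ]t))
    (admissible-up : ∀ {Γ Δ i} {A : Ty Γ i} {γ : Sub Δ Γ} →
                     Admissible γ → Admissible (up A γ))
    where

    NfTy-[] : ∀ {Γ Δ i} {A : Ty Γ i} {γ : Sub Δ Γ} →
              Admissible γ → NfTy M A → NfTy M (A [ γ ]T)
    NfTm-[] : ∀ {Γ Δ i} {A : Ty Γ i} {a : Tm Γ A} {γ : Sub Δ Γ} →
              Admissible γ → NfTm M a → NfTm M (a [ γ ]t)

    NfTy-[] adm (nf-Π nA nB) =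
      subst (NfTy M) (sym Π[]) (nf-Π (NfTy-[] adm nA) (NfTy-[] (admissible-up adm) nB))
    NfTy-[] _ nf-U = subst (NfTy M) (sym U[]) nf-U
    NfTy-[] adm (nf-El _ na) =
      subst (NfTy M) (sym El[]) (nf-El nf-U (NfTm-subst U[] (NfTm-[] adm na)))
    NfTy-[] adm (nf-Lift nA) = subst (NfTy M) (sym Lift[]) (nf-Lift (NfTy-[] adm nA))

    NfTm-[] adm (nf-var v) = admissible-var adm v
    NfTm-[] adm (nf-lam nA nB nb) =
      Tm-subst (NfTm M) (sym Π[]) (≅.sym lam[])
        (nf-lam (NfTy-[] adm nA) (NfTy-[] (admissible-up adm) nB) (NfTm-[] (admissible-up adm) nb))
    NfTm-[] adm (nf-app nA nB nt na) =
      Tm-subst (NfTm M) (sym [⟨⟩][]T) (≅.sym ·[])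
        (nf-app (NfTy-[] adm nA) (NfTy-[] (admissible-up adm) nB)
                (NfTm-subst Π[] (NfTm-[] adm nt)) (NfTm-[] adm na))
    NfTm-[] adm (nf-c nA) = Tm-subst (NfTm M) (sym U[]) (≅.sym c[]) (nf-c (NfTy-[] adm nA))
    NfTm-[] adm (nf-mk nA na) =
      Tm-subst (NfTm M) (sym Lift[]) (≅.sym mk[]) (nf-mk (NfTy-[] adm nA) (NfTm-[] adm na))
    NfTm-[] adm (nf-un nA na) =
      Tm-subst (NfTm M) refl (≅.sym (≡-to-≅ un[]))
        (nf-un (NfTy-[] adm nA) (NfTm-subst Lift[] (NfTm-[] adm na)))

module _ (S : Model) (S-syntax : IsSyntax S) where
  open Model S
  open Properties S

  Ext : Set
  Ext = Σ Con λ Γ → Σ ℕ (Ty Γ)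

  ▹-injective : ∀ {Γ Γ' i i'} {A : Ty Γ i} {A' : Ty Γ' i'} →
                Γ' ▹ A' ≡ Γ ▹ A → _≡_ {A = Ext} (Γ' , i' , A') (Γ , i , A)
  ▹-injective e = trans (sym ▹∘) (trans (cong Con∘ e) ▹∘)
    where open Section (S-syntax (constDModel Ext (◇ , 1 , U 0) (λ A → _ , _ , A)))

  data VarView {Γ i} (A : Ty Γ i) : ∀ {j} {C : Ty (Γ ▹ A) j} → Tm (Γ ▹ A) C → Set where
    view-q : VarView A (q A)
    view-p : ∀ {j} {B : Ty Γ j} {y : Tm Γ B} → IsVar S y → VarView A (y [ p A ]t)

  -- Since _▹_ is not a constructor, IsVar cannot be matched at index Γ ▹ A;
  -- the context is generalised and then inverted with ▹-injective.
  module _ {Γ i} {A : Ty Γ i} where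
    varViewAt : ∀ {Ω j} {C : Ty Ω j} {x : Tm Ω C} → IsVar S x →
                (e : Ω ≡ Γ ▹ A) → VarView A (coeF (λ Ω C → Tm Ω C) e x)
    varViewAt var-q e with ▹-injective e
    varViewAt var-q refl | refl = view-q
    varViewAt (var-p v) e with ▹-injective e
    varViewAt (var-p v) refl | refl = view-p v

    varView : ∀ {j} {C : Ty (Γ ▹ A) j} {x : Tm (Γ ▹ A) C} → IsVar S x → VarView A x
    varView v = varViewAt v refl

  IsRen : ∀ {Δ Γ} → Sub Δ Γ → Set
  IsRen {Γ = Γ} γ = ∀ {j} {C : Ty Γ j} {x : Tm Γ C} → IsVar S x → IsVar S (x [ γ ]t)

  IsNfSub : ∀ {Δ Γ} → Sub Δ Γ → Set
  IsNfSub {Γ = Γ} γ = ∀ {j} {C : Ty Γ j} {x : Tm Γ C} → IsVar S x → NfTm S (x [ γ ]t)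

  IsVar-q[up] : ∀ {Γ Δ i} {A : Ty Γ i} {γ : Sub Δ Γ} → IsVar S (q A [ up A γ ]t)
  IsVar-q[up] = Tm-subst (IsVar S) (sym [p][up]T) (≅.sym q[up]) var-q

  up-IsRen : ∀ {Γ Δ i} {A : Ty Γ i} {γ : Sub Δ Γ} → IsRen γ → IsRen (up A γ)
  up-IsRen ρ v with varView v
  ... | view-q = IsVar-q[up]
  ... | view-p w = Tm-subst (IsVar S) (sym [p][up]T) (≅.sym [p][up]t) (var-p (ρ w))

  -- Lifting an α-normal substitution under a binder weakens α-normal terms,
  -- so instantiation is first established for renamings.
  module Renaming = Instantiation IsRen (λ ρ v → nf-var (ρ v)) up-IsRen

  NfTm-[p] : ∀ {Γ i j} {A : Ty Γ i} {B : Ty Γ j} {b : Tm Γ B} →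
             NfTm S b → NfTm S (b [ p A ]t)
  NfTm-[p] = Renaming.NfTm-[] var-p

  up-IsNfSub : ∀ {Γ Δ i} {A : Ty Γ i} {γ : Sub Δ Γ} → IsNfSub γ → IsNfSub (up A γ)
  up-IsNfSub σ v with varView v
  ... | view-q = nf-var IsVar-q[up]
  ... | view-p w = Tm-subst (NfTm S) (sym [p][up]T) (≅.sym [p][up]t) (NfTm-[p] (σ w))

  p-IsNfSub : ∀ {Γ i} {A : Ty Γ i} → IsNfSub (p A)
  p-IsNfSub v = nf-var (var-p v)

  ⟨⟩-IsNfSub : ∀ {Γ i} {A : Ty Γ i} {a : Tm Γ A} → NfTm S a → IsNfSub ⟨ a ⟩
  ⟨⟩-IsNfSub na v with varView v
  ... | view-q = Tm-subst (NfTm S) (sym [p][⟨⟩]T) (≅.sym q[⟨⟩]) na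
  ... | view-p w = Tm-subst (NfTm S) (sym [p][⟨⟩]T) (≅.sym [p][⟨⟩]t) (nf-var w)

  open Instantiation IsNfSub id up-IsNfSub

  αNormality : DModel S
  αNormality = record
    { Con∙ = λ _ → ⊤
    ; Ty∙ = λ _ A → Irrelevant (NfTy S A)
    ; Sub∙ = λ _ _ γ → Irrelevant (IsNfSub γ)
    ; Tm∙ = λ _ _ a → Irrelevant (NfTm S a)
    ; ◇∙ = tt
    ; _▹∙_ = λ _ _ → tt
    ; _[_]T∙ = λ A∙ γ∙ → ⦇ NfTy-[] γ∙ A∙ ⦈
    ; _[_]t∙ = λ a∙ γ∙ → ⦇ NfTm-[] γ∙ a∙ ⦈
    ; p∙ = λ _ → [ p-IsNfSub ]
    ; q∙ = λ _ → [ nf-var var-q ]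
    ; ⟨_⟩∙ = map ⟨⟩-IsNfSub
    ; up∙ = λ _ → map up-IsNfSub
    ; [p][up]T∙ = Ty∙-≅ [p][up]T
    ; [p][up]t∙ = Tm∙-≅ [p][up]T [p][up]t
    ; q[up]∙ = Tm∙-≅ [p][up]T q[up]
    ; [p][⟨⟩]T∙ = Ty∙-≅ [p][⟨⟩]T
    ; [p][⟨⟩]t∙ = Tm∙-≅ [p][⟨⟩]T [p][⟨⟩]t
    ; q[⟨⟩]∙ = Tm∙-≅ [p][⟨⟩]T q[⟨⟩]
    ; [⟨⟩][]T∙ = Ty∙-≅ [⟨⟩][]T
    ; [up][⟨q⟩]T∙ = Ty∙-≅ [up][⟨q⟩]T
    ; Π∙ = λ A∙ B∙ → ⦇ nf-Π A∙ B∙ ⦈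
    ; Π[]∙ = Ty∙-≅ Π[]
    ; lam∙ = λ {A∙ = A∙} {B∙ = B∙} b∙ → ⦇ nf-lam A∙ B∙ b∙ ⦈
    ; lam[]∙ = Tm∙-≅ Π[] lam[]
    ; _·∙_ = λ {A∙ = A∙} {B∙ = B∙} t∙ a∙ → ⦇ nf-app A∙ B∙ t∙ a∙ ⦈
    ; ·[]∙ = Tm∙-≅ [⟨⟩][]T ·[]
    ; Πβ∙ = Tm∙-≅ refl (≡-to-≅ Πβ)
    ; Πη∙ = Tm∙-≅ (cong (Π _) (sym [up][⟨q⟩]T)) Πη
    ; U∙ = λ _ → [ nf-U ]
    ; U[]∙ = Ty∙-≅ U[]
    ; El∙ = map (nf-El nf-U)
    ; El[]∙ = Ty∙-≅ El[]
    ; c∙ = map nf-c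
    ; c[]∙ = Tm∙-≅ U[] c[]
    ; Elc∙ = Ty∙-≅ Elc
    ; cEl∙ = Tm∙-≅ refl (≡-to-≅ cEl)
    ; Lift∙ = map nf-Lift
    ; Lift[]∙ = Ty∙-≅ Lift[]
    ; mk∙ = λ {A∙ = A∙} a∙ → ⦇ nf-mk A∙ a∙ ⦈
    ; mk[]∙ = Tm∙-≅ Lift[] mk[]
    ; un∙ = λ {A∙ = A∙} a∙ → ⦇ nf-un A∙ a∙ ⦈
    ; un[]∙ = Tm∙-≅ refl (≡-to-≅ un[])
    ; Liftβ∙ = Tm∙-≅ refl (≡-to-≅ Liftβ)
    ; Liftη∙ = Tm∙-≅ refl (≡-to-≅ Liftη)
    }
    where
    Ty∙-≅ : ∀ {Γ i} {A A' : Ty Γ i} → A ≡ A' →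
            {x : Irrelevant (NfTy S A)} {y : Irrelevant (NfTy S A')} → x ≅ y
    Ty∙-≅ e = Irrelevant-≅ (cong (NfTy S) e) _ _

    Tm∙-≅ : ∀ {Γ i} {A A' : Ty Γ i} {a : Tm Γ A} {a' : Tm Γ A'} → A ≡ A' → a ≅ a' →
            {x : Irrelevant (NfTm S a)} {y : Irrelevant (NfTm S a')} → x ≅ y
    Tm∙-≅ e h = Irrelevant-≅ (Tm-cong (NfTm S) e h) _ _

mainTheorem2 : (S : Model) → IsSyntax S →
    ((Γ : Model.Con S) (i : ℕ) (A : Model.Ty S Γ i) → Irrelevant (NfTy S A))
    × ((Γ : Model.Con S) (i : ℕ) (A : Model.Ty S Γ i) (a : Model.Tm S Γ A) → Irrelevant (NfTm S a))
mainTheorem2 S S-syntax = (λ _ _ A → Ty∘ A) , (λ _ _ _ a → Tm∘ a)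
  where open Section (S-syntax (αNormality S S-syntax))
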